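{- Let $\mathcal{D}=\{(\Sigma_k,L_k,G_k)\}_{k}$ be a treelike decomposition class of arity $r$ and of complexity $f:\mathbb{N}\to\mathbb{N}$, and let $C$ be a finite, $\mathcal{D}$-coherent treelike DP-core. If $P(\mathcal{D}_k)\not\subseteq P(C,\mathcal{D})$, then there is a $\mathcal{D}$-decomposition $\tau\in L_k$ such that $G(\tau)\in P(\mathcal{D}_k)\setminus P(C,\mathcal{D})$, $\tau$ has height at most $f(k)\cdot\delta_C(k)-1$, and $|\tau|\le f(k)\cdot\delta_C(k)$ if $r=1$, and $|\tau|\le r^{f(k)\cdot\delta_C(k)}$ if $r>1$.
   Context: Graphs: triples $G=(V,E,I)$, $V,E$ finite subsets of $\mathbb{N}$, $I\subseteq E\times V$; $\simeq$ isomorphism; isomorphism closure of a set of graphs = all graphs isomorphic to one of its members. Terms over a ranked alphabet: finite rooted ordered labelled trees (arity = number of children); $|\tau|$ = number of nodes. Treelike decomposition class of arity $r$: $\mathcal{D}=\{(\Sigma_k,L_k,G_k)\}_{k}$, $\Sigma_k$ ranked alphabet of arity $\le r$, $L_k$ regular tree language over $\Sigma_k$, $G_k:L_k\to$ graphs, $\Sigma_k\subseteq\Sigma_{k+1}$, $L_k\subseteq L_{k+1}$, $G_{k+1}|_{L_k}=G_k$; $G(\tau)=G_k(\tau)$; $P(\mathcal{D}_k)$ = isomorphism closure of $\{G(\tau):\tau\in L_k\}$. $\mathcal{D}$ has complexity $f$ if there are tree automata $A_k$ with language $L_k$ having at most $f(k)$ states, constructible from $k$ in time $k^{O(1)}f(k)^{O(r)}$.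 Treelike DP-core $C=\{C[k]\}$, $C[k]=(\Sigma_k,W_k,F_k,T_k,\mathrm{Clean}_k,\mathrm{Inv}_k)$: $W_k\subseteq\{0,1\}^*$ decidable; $F_k:W_k\to\{0,1\}$ (final witnesses); finite $\hat a\subseteq W_k$ for arity-$0$ $a$; $\hat a:W_k^p\to$ finite subsets of $W_k$ for arity $p\ge1$; $\mathrm{Clean}_k$, $\mathrm{Inv}_k$ map finite subsets of $W_k$ to finite subsets of $W_k$, resp. $\{0,1\}^*$. $\hat a(S_1,\dots,S_p)=\mathrm{Clean}_k(\bigcup_{w_i\in S_i}\hat a(w_1,\dots,w_p))$; $\mathrm{Dyn}_k(a)=\hat a$ (arity 0), $\mathrm{Dyn}_k(a(\tau_1,\dots,\tau_p))=\hat a(\mathrm{Dyn}_k(\tau_1),\dots,\mathrm{Dyn}_k(\tau_p))$; $\tau$ accepted by $C[k]$ iff $\mathrm{Dyn}_k(\tau)$ has a final witness. $P(C,\mathcal{D})$ = isomorphism closure of $\{G(\tau):\tau\in L_k$ accepted by $C[k]$, some $k\}$. $\mathcal{D}$-coherent: alphabets of $C$ are the $\Sigma_k$; for $\tau\in L_k,\tau'\in L_{k'}$ with $G(\tau)\simeq G(\tau')$, acceptance by $C[k]$, $C[k']$ agree and $\mathrm{Inv}_k(\mathrm{Dyn}_k(\tau))=\mathrm{Inv}_{k'}(\mathrm{Dyn}_{k'}(\tau'))$. Measures: $S\subseteq W_k$ is $(C,k,n)$-useful if $S=\mathrm{Dyn}_k(\tau)$ for a term $\tau$ over $\Sigma_k$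 with $|\tau|\le n$; $\beta_C(k,n)$ = max bit-length of a witness in a useful set; $\delta_C(k,n)$ = number of useful sets. $C$ is finite if $\beta_C(k,n)\le g(k)$ for some $g$ and all $n$; then $\delta_C(k)$ denotes the ($n$-independent) number of useful sets. -}

module Defs where

open import Data.Nat using (ℕ; zero; suc; _≤_)
open import Data.Bool using (Bool; true; false)
open import Data.Fin using (Fin)
open import Data.List using (List; []; _∷_; [_]; concatMap; map)
open import Data.List.Membership.Propositional using (_∈_)
open import Data.Vec using (Vec; []; _∷_; lookup)
open import Data.Product using (Σ; ∃; _×_; _,_)
open import Relation.Binary.PropositionalEquality using (_≡_)
open import Relation.Nullary using (¬_)
open import Function.Bundles using (_⇔_)

-- Graphs  G = (V, E, I),  V, E finite subsets of ℕ,  I ⊆ E × V.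
-- Finite subsets of ℕ are given by lists (only membership matters).

record Graph : Set where
  field
    V  : List ℕ
    E  : List ℕ
    I  : List (ℕ × ℕ)
    I⊆E×V : ∀ e v → (e , v) ∈ I → (e ∈ E) × (v ∈ V)

open Graph public

record Iso (G H : Graph) : Set where
  field
    fV gV fE gE : ℕ → ℕ
    fV∈ : ∀ v → v ∈ V G → fV v ∈ V H
    gV∈ : ∀ v → v ∈ V H → gV v ∈ V G
    gfV : ∀ v → v ∈ V G → gV (fV v) ≡ v
    fgV : ∀ v → v ∈ V H → fV (gV v) ≡ v
    fE∈ : ∀ e → e ∈ E G → fE e ∈ E H
    gE∈ : ∀ e → e ∈ E H → gE e ∈ E G
    gfE : ∀ e → e ∈ E G → gE (fE e) ≡ e
    fgE : ∀ e → e ∈ E H → fE (gE e) ≡ e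
    inc : ∀ e v → e ∈ E G → v ∈ V G → ((e , v) ∈ I G ⇔ (fE e , fV v) ∈ I H)

Word : Set
Word = List Bool

WSet : Set
WSet = List Word

_≋_ : WSet → WSet → Set
S ≋ T = ∀ w → (w ∈ S ⇔ w ∈ T)

module Ranked (Sym : Set) (arity : Sym → ℕ) where

  data Term : Set where
    node : (a : Sym) → Vec Term (arity a) → Term

  mutual
    size : Term → ℕ
    size (node a ts) = suc (sizes ts)

    sizes : ∀ {n} → Vec Term n → ℕ
    sizes [] = 0
    sizes (t ∷ ts) = size t Data.Nat.+ sizes ts

  -- height: a single node has height 0
  mutual
    height : Term → ℕ
    height (node a ts) = heights ts

    heights : ∀ {n} → Vec Term n → ℕ
    heights [] = 0
    heights (t ∷ ts) = suc (height t) Data.Nat.⊔ heights ts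

  data Over (Σ' : List Sym) : Term → Set where
    over : ∀ {a ts} → a ∈ Σ' → (∀ i → Over Σ' (lookup ts i)) → Over Σ' (node a ts)

  record TreeAutomaton : Set where
    field
      states : ℕ
      Δ      : (a : Sym) → Vec (Fin states) (arity a) → Fin states → Bool
      final  : Fin states → Bool

  module _ (A : TreeAutomaton) where
    open TreeAutomaton A
    data Reaches : Term → Fin states → Set where
      run : ∀ {a ts q} (qs : Vec (Fin states) (arity a)) → Δ a qs q ≡ true →
            (∀ i → Reaches (lookup ts i) (lookup qs i)) → Reaches (node a ts) q

    Accepts : Term → Set
    Accepts τ = Σ (Fin states) λ q → final q ≡ true × Reaches τ q

  Recognises : List Sym → TreeAutomaton → (Term → Set) → Set
  Recognises Σ' A L = ∀ τ → (L τ ⇔ (Over Σ' τ × Accepts A τ))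

  IsRegular : List Sym → (Term → Set) → Set
  IsRegular Σ' L = Σ TreeAutomaton λ A → Recognises Σ' A L

  -- Treelike decomposition classes of arity r.
  -- The compatible family G_k : L_k → graphs is given as one function G
  -- (G(τ) = G_k(τ) for τ ∈ L_k; values outside ⋃ L_k are irrelevant).

  record DecompClass (r : ℕ) : Set₁ where
    field
      Σₖ      : ℕ → List Sym
      Σ-arity : ∀ k a → a ∈ Σₖ k → arity a ≤ r
      Σ-mono  : ∀ k a → a ∈ Σₖ k → a ∈ Σₖ (suc k)
      L       : ℕ → Term → Set
      L-reg   : ∀ k → IsRegular (Σₖ k) (L k)
      L-mono  : ∀ k τ → L k τ → L (suc k) τ
      G       : Term → Graph

  -- complexity f (state bound; the construction-time bound is not modelled)
  HasComplexity : ∀ {r} → DecompClass r → (ℕ → ℕ) → Set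
  HasComplexity D f = ∀ k → Σ TreeAutomaton λ A →
    (TreeAutomaton.states A ≤ f k) × Recognises (DecompClass.Σₖ D k) A (DecompClass.L D k)

  PD : ∀ {r} → DecompClass r → ℕ → Graph → Set
  PD D k H = Σ Term λ τ → DecompClass.L D k τ × Iso (DecompClass.G D τ) H

  -- Treelike DP-cores (alphabet of C[k] is Σ_k of the class it is used with)

  record DPCore : Set where
    field
      W     : ℕ → Word → Bool
      F     : ℕ → Word → Bool
      hat   : ℕ → (a : Sym) → Vec Word (arity a) → WSet
      hat-W : ∀ k a ws → (∀ i → W k (lookup ws i) ≡ true) →
              ∀ w → w ∈ hat k a ws → W k w ≡ true
      Clean : ℕ → WSet → WSet
      Clean-W : ∀ k S → (∀ w → w ∈ S → W k w ≡ true) →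
                ∀ w → w ∈ Clean k S → W k w ≡ true
      Clean-set : ∀ k S T → S ≋ T → Clean k S ≋ Clean k T
      Inv   : ℕ → WSet → WSet
      Inv-set : ∀ k S T → S ≋ T → Inv k S ≋ Inv k T

  module _ (C : DPCore) where
    open DPCore C

    tuples : ∀ {p} → Vec WSet p → List (Vec Word p)
    tuples [] = [ [] ]
    tuples (S ∷ Ss) = concatMap (λ w → map (w ∷_) (tuples Ss)) S

    combine : ℕ → ∀ {p} → (Vec Word p → WSet) → Vec WSet p → WSet
    combine k {zero} h Ss = h []
    combine k {suc p} h Ss = Clean k (concatMap h (tuples Ss))

    mutual
      Dyn : ℕ → Term → WSet
      Dyn k (node a ts) = combine k (hat k a) (Dyns k ts)

      Dyns : ℕ → ∀ {n} → Vec Term n → Vec WSet n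
      Dyns k [] = []
      Dyns k (t ∷ ts) = Dyn k t ∷ Dyns k ts

    AcceptedBy : ℕ → Term → Set
    AcceptedBy k τ = Σ Word λ w → w ∈ Dyn k τ × F k w ≡ true

  module _ {r : ℕ} (D : DecompClass r) (C : DPCore) where
    open DecompClass D
    open DPCore C

    PCD : Graph → Set
    PCD H = Σ ℕ λ k → Σ Term λ τ → L k τ × AcceptedBy C k τ × Iso (G τ) H

    Coherent : Set
    Coherent = ∀ k k' τ τ' → L k τ → L k' τ' → Iso (G τ) (G τ') →
      (AcceptedBy C k τ ⇔ AcceptedBy C k' τ') ×
      (Inv k (Dyn C k τ) ≋ Inv k' (Dyn C k' τ'))

    Useful : ℕ → WSet → Set
    Useful k S = Σ Term λ τ → Over (Σₖ k) τ × S ≋ Dyn C k τ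

    -- C is finite: β_C(k,n) ≤ g(k) for all n, i.e. every witness in a
    -- useful set has bit-length ≤ g(k)
    FiniteCore : Set
    FiniteCore = Σ (ℕ → ℕ) λ g → ∀ k τ → Over (Σₖ k) τ →
      ∀ w → w ∈ Dyn C k τ → Data.List.length w ≤ g k

    -- d = δ_C(k): the number of (distinct) useful sets
    NumUseful : ℕ → ℕ → Set
    NumUseful k d = Σ (Vec WSet d) λ Ss →
      (∀ i → Useful k (lookup Ss i)) ×
      (∀ i j → lookup Ss i ≋ lookup Ss j → i ≡ j) ×
      (∀ S → Useful k S → Σ (Fin d) λ i → S ≋ lookup Ss i)

{-# OPTIONS --safe #-}
-- Fix an accepting run of the automaton for L_k on a decomposition of a graph
-- outside P(C, D) and rebuild the term bottom-up, replacing every subterm by the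
-- first term met earlier with the same pair (state of the run, DP set).  Runs and
-- DP sets are both computed locally from the children, so the rebuilt term is
-- again in L_k and has the same DP set; by coherence its graph is still outside
-- P(C, D).  A subterm is kept only when its pair is new, and it is at most as high
-- as the number of pairs seen before it, so the height stays below
-- f(k) · δ_C(k), the number of possible pairs.  The size bounds follow since all
-- arities are at most r.  Finiteness of C is needed only to make δ_C(k) finite,
-- which the given count of useful sets already provides.
module Submission where

open import Defs
open import Data.Nat using (ℕ; zero; suc; _≤_; _<_; _*_; _∸_; _^_; _+_; z≤n; s≤s)
open import Data.Nat.Properties
open import Data.Product using (Σ; _×_; _,_; proj₁)
open import Data.Sum using (inj₁; inj₂)
open import Data.Empty using (⊥-elim)
open import Data.List using (List)
open import Data.List.Membership.Propositional using (_∈_)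
open import Data.List.Relation.Binary.BagAndSetEquality using (_∼[_]_; set; map-cong; >>=-cong)
open import Data.Vec using (Vec; []; _∷_; lookup)
open import Data.Vec.Relation.Binary.Pointwise.Inductive using (Pointwise; []; _∷_)
open import Data.Fin as Fin using (Fin; zero; suc)
open import Data.Fin.Properties using (combine-injective)
open import Data.Fin.Subset using (Subset; ⁅_⁆; _∪_; ∣_∣) renaming (_∈_ to _∈ₛ_; _∉_ to _∉ₛ_; ⊥ to ∅)
open import Data.Fin.Subset.Properties
  using (∣p∣≤n; p⊂q⇒∣p∣<∣q∣; p⊆p∪q; x∈p∪q⁺; x∈p∪q⁻; x∈⁅x⁆; x∈⁅y⁆⇒x≡y; ∉⊥)
  renaming (_∈?_ to _∈ₛ?_)
open import Function using (_∘_)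
open import Function.Bundles using (Equivalence)
import Function.Properties.Equivalence as ⇔
open import Relation.Binary.PropositionalEquality using (_≡_; refl; sym; cong)
open import Relation.Nullary using (¬_; yes; no)

≋-refl : ∀ {S} → S ≋ S
≋-refl _ = ⇔.refl

≋-sym : ∀ {S T} → S ≋ T → T ≋ S
≋-sym S≋T w = ⇔.sym (S≋T w)

≋-trans : ∀ {S T U} → S ≋ T → T ≋ U → S ≋ U
≋-trans S≋T T≋U w = ⇔.trans (S≋T w) (T≋U w)

≋⇒∼[set] : ∀ {S T} → S ≋ T → S ∼[ set ] T
≋⇒∼[set] S≋T {w} = S≋T w

∼[set]⇒≋ : ∀ {S T} → S ∼[ set ] T → S ≋ T
∼[set]⇒≋ S∼T w = S∼T {w}

Iso-refl : ∀ G → Iso G G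
Iso-refl G = record
  { fV = λ v → v ; gV = λ v → v ; fE = λ e → e ; gE = λ e → e
  ; fV∈ = λ _ v∈ → v∈ ; gV∈ = λ _ v∈ → v∈ ; gfV = λ _ _ → refl ; fgV = λ _ _ → refl
  ; fE∈ = λ _ e∈ → e∈ ; gE∈ = λ _ e∈ → e∈ ; gfE = λ _ _ → refl ; fgE = λ _ _ → refl
  ; inc = λ _ _ _ _ → ⇔.refl
  }

maxSize : ℕ → ℕ → ℕ
maxSize r zero = 0
maxSize r (suc h) = suc (r * maxSize r h)

maxSize[1,h]≡h : ∀ h → maxSize 1 h ≡ h
maxSize[1,h]≡h zero = refl
maxSize[1,h]≡h (suc h) rewrite *-identityˡ (maxSize 1 h) = cong suc (maxSize[1,h]≡h h)

maxSize<^ : ∀ {r} → 1 < r → ∀ h → maxSize r h < r ^ h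
maxSize<^ r>1 zero = s≤s z≤n
maxSize<^ {r} r>1 (suc h) = begin-strict
  1 + r * m    <⟨ +-monoˡ-< (r * m) r>1 ⟩
  r + r * m    ≡⟨ sym (*-suc r m) ⟩
  r * suc m    ≤⟨ *-monoʳ-≤ r (maxSize<^ r>1 h) ⟩
  r * r ^ h    ∎
  where
  open ≤-Reasoning
  m : ℕ
  m = maxSize r h

module _ {Sym : Set} {arity : Sym → ℕ} where
  open Ranked Sym arity

  module _ (C : DPCore) (k : ℕ) where

    tuples-cong : ∀ {p} {Ss Ts : Vec WSet p} → Pointwise _≋_ Ss Ts →
      tuples C Ss ∼[ set ] tuples C Ts
    tuples-cong [] = ⇔.refl
    tuples-cong (S≋T ∷ Ss≋Ts) =
      >>=-cong (≋⇒∼[set] S≋T) (λ _ → map-cong (λ _ → refl) (tuples-cong Ss≋Ts))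

    combine-cong : ∀ {p} (h : Vec Word p → WSet) {Ss Ts : Vec WSet p} →
      Pointwise _≋_ Ss Ts → combine C k h Ss ≋ combine C k h Ts
    combine-cong {zero} h _ = ≋-refl
    combine-cong {suc p} h Ss≋Ts = DPCore.Clean-set C k _ _
      (∼[set]⇒≋ (>>=-cong (tuples-cong Ss≋Ts) (λ _ → ⇔.refl)))

    Dyn-node-cong : ∀ a {ts ts' : Vec Term (arity a)} →
      Pointwise _≋_ (Dyns C k ts) (Dyns C k ts') → Dyn C k (node a ts) ≋ Dyn C k (node a ts')
    Dyn-node-cong a = combine-cong (DPCore.hat C k a)

    AcceptedBy-resp-≋ : ∀ {t t'} → Dyn C k t ≋ Dyn C k t' → AcceptedBy C k t → AcceptedBy C k t'
    AcceptedBy-resp-≋ t≋t' (w , w∈ , final) = w , Equivalence.to (t≋t' w) w∈ , final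

  module _ {Σ' : List Sym} {r : ℕ} (arity≤r : ∀ a → a ∈ Σ' → arity a ≤ r) where
    mutual
      size≤maxSize : ∀ {t h} → Over Σ' t → height t < h → size t ≤ maxSize r h
      size≤maxSize {node a ts} {suc h} (over a∈Σ' ts-over) (s≤s ts<h) =
        s≤s (≤-trans (sizes≤ {ts = ts} ts-over ts<h) (*-monoˡ-≤ (maxSize r h) (arity≤r a a∈Σ')))

      sizes≤ : ∀ {n h} {ts : Vec Term n} → (∀ i → Over Σ' (lookup ts i)) →
        heights ts ≤ h → sizes ts ≤ n * maxSize r h
      sizes≤ {ts = []} _ _ = z≤n
      sizes≤ {ts = t ∷ ts} ts-over ts≤h =
        +-mono-≤ (size≤maxSize {t} (ts-over zero) (m⊔n≤o⇒m≤o (suc (height t)) (heights ts) ts≤h))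
                 (sizes≤ {ts = ts} (ts-over ∘ suc) (m⊔n≤o⇒n≤o (suc (height t)) _ ts≤h))

  module Pumping (Σ' : List Sym) (C : DPCore) (k : ℕ) (A : TreeAutomaton)
    {d : ℕ} (Ss : Vec WSet d)
    (classify : ∀ {t} → Over Σ' t → Σ (Fin d) λ i → Dyn C k t ≋ lookup Ss i) where
    open TreeAutomaton A using (states)

    record Representative (q : Fin states) (S : WSet) (h : ℕ) : Set where
      field
        term    : Term
        overΣ   : Over Σ' term
        reaches : Reaches A term q
        dyn     : Dyn C k term ≋ S
        height< : height term < h
    open Representative

    selfRepresentative : ∀ {t q h} → Over Σ' t → Reaches A t q → height t < h →
      Representative q (Dyn C k t) h
    selfRepresentative {t} t-over t-reaches t<h = record
      { term = t ; overΣ = t-over ; reaches = t-reaches ; dyn = ≋-refl ; height< = t<h }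

    Representative-mono : ∀ {q S h h'} → h ≤ h' → Representative q S h → Representative q S h'
    Representative-mono h≤h' ρ = record
      { term = term ρ ; overΣ = overΣ ρ ; reaches = reaches ρ ; dyn = dyn ρ
      ; height< = ≤-trans (height< ρ) h≤h' }

    Representative-resp-≋ : ∀ {q S S' h} → S ≋ S' → Representative q S h → Representative q S' h
    Representative-resp-≋ S≋S' ρ = record
      { term = term ρ ; overΣ = overΣ ρ ; reaches = reaches ρ ; dyn = ≋-trans (dyn ρ) S≋S'
      ; height< = height< ρ }

    record Representatives {n} (qs : Vec (Fin states) n) (Ss' : Vec WSet n) (h : ℕ) : Set where
      field
        terms    : Vec Term n
        oversΣ   : ∀ i → Over Σ' (lookup terms i)
        reachess : ∀ i → Reaches A (lookup terms i) (lookup qs i)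
        dyns     : Pointwise _≋_ (Dyns C k terms) Ss'
        heights≤ : heights terms ≤ h
    open Representatives

    []ᴿ : ∀ {h} → Representatives [] [] h
    []ᴿ = record { terms = [] ; oversΣ = λ () ; reachess = λ () ; dyns = [] ; heights≤ = z≤n }

    _∷ᴿ_ : ∀ {n q S h} {qs : Vec (Fin states) n} {Ss'} →
      Representative q S h → Representatives qs Ss' h → Representatives (q ∷ qs) (S ∷ Ss') h
    ρ ∷ᴿ ρs = record
      { terms    = term ρ ∷ terms ρs
      ; oversΣ   = λ { zero → overΣ ρ ; (suc i) → oversΣ ρs i }
      ; reachess = λ { zero → reaches ρ ; (suc i) → reachess ρs i }
      ; dyns     = dyn ρ ∷ dyns ρs
      ; heights≤ = ⊔-lub (height< ρ) (heights≤ ρs)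
      }

    N : ℕ
    N = states * d

    key : Fin states → Fin d → Fin N
    key = Fin.combine

    record Table : Set where
      field
        keys  : Subset N
        entry : ∀ {q i} → key q i ∈ₛ keys → Representative q (lookup Ss i) ∣ keys ∣
    open Table

    record Grown (T : Table) (P : ℕ → Set) : Set where
      constructor grown
      field
        table  : Table
        larger : ∣ keys T ∣ ≤ ∣ keys table ∣
        result : P ∣ keys table ∣

    emptyTable : Table
    emptyTable = record { keys = ∅ ; entry = λ ∅∋key → ⊥-elim (∉⊥ ∅∋key) }

    insertFresh : ∀ {q i} (T : Table) → key q i ∉ₛ keys T →
      Representative q (lookup Ss i) (suc ∣ keys T ∣) → Σ Table λ T' → ∣ keys T ∣ < ∣ keys T' ∣
    insertFresh {q} {i} T fresh ρ = T' , grows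
      where
      keys' : Subset N
      keys' = keys T ∪ ⁅ key q i ⁆
      grows : ∣ keys T ∣ < ∣ keys' ∣
      grows = p⊂q⇒∣p∣<∣q∣ (p⊆p∪q ⁅ key q i ⁆ , key q i , x∈p∪q⁺ (inj₂ (x∈⁅x⁆ (key q i))) , fresh)
      entry' : ∀ {q' i'} → key q' i' ∈ₛ keys' → Representative q' (lookup Ss i') ∣ keys' ∣
      entry' {q'} {i'} ∈keys' with x∈p∪q⁻ (keys T) ⁅ key q i ⁆ ∈keys'
      ... | inj₁ ∈keys = Representative-mono (<⇒≤ grows) (entry T ∈keys)
      ... | inj₂ ∈⁅key⁆ with combine-injective q' i' q i (x∈⁅y⁆⇒x≡y (key q i) ∈⁅key⁆)
      ...   | refl , refl = Representative-mono grows ρ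
      T' : Table
      T' = record { keys = keys' ; entry = entry' }

    insert : ∀ {t q} (T : Table) → Over Σ' t → Reaches A t q → height t ≤ ∣ keys T ∣ →
      Grown T (Representative q (Dyn C k t))
    insert {t} {q} T t-over t-reaches t≤T with classify t-over
    ... | i , t≋i with key q i ∈ₛ? keys T
    ...   | yes ∈keys = grown T ≤-refl (Representative-resp-≋ (≋-sym t≋i) (entry T ∈keys))
    ...   | no fresh with insertFresh T fresh
                            (Representative-resp-≋ t≋i (selfRepresentative t-over t-reaches (s≤s t≤T)))
    ...     | T' , grows =
              grown T' (<⇒≤ grows) (selfRepresentative t-over t-reaches (≤-trans (s≤s t≤T) grows))

    mutual
      rebuild : ∀ {t q} (T : Table) → Over Σ' t → Reaches A t q →
        Grown T (Representative q (Dyn C k t))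
      rebuild {node a ts} T (over a∈Σ' ts-over) (run qs δ ts-reach)
        with rebuildAll {ts = ts} {qs} T ts-over ts-reach
      ... | grown T₁ T≤T₁ ρs
        with insert T₁ (over a∈Σ' (oversΣ ρs)) (run qs δ (reachess ρs)) (heights≤ ρs)
      ... | grown T₂ T₁≤T₂ ρ =
        grown T₂ (≤-trans T≤T₁ T₁≤T₂) (Representative-resp-≋ (Dyn-node-cong C k a (dyns ρs)) ρ)

      rebuildAll : ∀ {n} {ts : Vec Term n} {qs} (T : Table) → (∀ i → Over Σ' (lookup ts i)) →
        (∀ i → Reaches A (lookup ts i) (lookup qs i)) → Grown T (Representatives qs (Dyns C k ts))
      rebuildAll {ts = []} {[]} T _ _ = grown T ≤-refl []ᴿ
      rebuildAll {ts = t ∷ ts} {q ∷ qs} T ts-over ts-reach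
        with rebuild T (ts-over zero) (ts-reach zero)
      ... | grown T₁ T≤T₁ ρ with rebuildAll {ts = ts} {qs} T₁ (ts-over ∘ suc) (ts-reach ∘ suc)
      ... | grown T₂ T₁≤T₂ ρs =
        grown T₂ (≤-trans T≤T₁ T₁≤T₂) (Representative-mono T₁≤T₂ ρ ∷ᴿ ρs)

    shrink : ∀ {t q} → Over Σ' t → Reaches A t q → Representative q (Dyn C k t) N
    shrink t-over t-reaches with rebuild emptyTable t-over t-reaches
    ... | grown T _ ρ = Representative-mono (∣p∣≤n (keys T)) ρ

  PCD⇒AcceptedBy : ∀ {r} {D : DecompClass r} {C : DPCore} → Coherent D C →
    ∀ {k τ} → DecompClass.L D k τ → PCD D C (DecompClass.G D τ) → AcceptedBy C k τ
  PCD⇒AcceptedBy coherent {k} {τ} τ∈L (k' , τ' , τ'∈L , τ'-accepted , G[τ']≅G[τ]) =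
    Equivalence.to (proj₁ (coherent k' k τ' τ τ'∈L τ∈L G[τ']≅G[τ])) τ'-accepted

corollary2 : {Sym : Set} {arity : Sym → ℕ} (r : ℕ)
    (D : Ranked.DecompClass Sym arity r) (f : ℕ → ℕ) →
    Ranked.HasComplexity Sym arity D f →
    (C : Ranked.DPCore Sym arity) →
    Ranked.FiniteCore Sym arity D C →
    Ranked.Coherent Sym arity D C →
    (k d : ℕ) → Ranked.NumUseful Sym arity D C k d →
    Σ Graph (λ H → Ranked.PD Sym arity D k H × ¬ Ranked.PCD Sym arity D C H) →
    Σ (Ranked.Term Sym arity) λ τ →
      Ranked.DecompClass.L D k τ ×
      Ranked.PD Sym arity D k (Ranked.DecompClass.G D τ) ×
      ¬ Ranked.PCD Sym arity D C (Ranked.DecompClass.G D τ) ×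
      Ranked.height Sym arity τ ≤ f k * d ∸ 1 ×
      (r ≡ 1 → Ranked.size Sym arity τ ≤ f k * d) ×
      (1 < r → Ranked.size Sym arity τ ≤ r ^ (f k * d))
corollary2 {Sym} {arity} r D f complexity C _ coherent k d (Ss , _ , _ , classify)
  (H , (τ₀ , τ₀∈L , G[τ₀]≅H) , H∉PCD)
  with complexity k
... | A , states≤fk , recognises
  with Equivalence.to (recognises τ₀) τ₀∈L
... | τ₀-over , q , q-final , τ₀-reaches =
  τ , τ∈L , (τ , τ∈L , Iso-refl (G τ)) , G[τ]∉PCD , <⇒≤pred τ<fk*d ,
  (λ { refl → ≤-trans size≤ (≤-reflexive (maxSize[1,h]≡h (f k * d))) }) ,
  (λ r>1 → ≤-trans size≤ (<⇒≤ (maxSize<^ r>1 (f k * d))))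
  where
  open Ranked Sym arity
  open DecompClass D
  open Pumping (Σₖ k) C k A Ss (λ {t} t-over → classify (Dyn C k t) (t , t-over , ≋-refl))
  open Representative (shrink τ₀-over τ₀-reaches) renaming (term to τ)
  τ∈L : L k τ
  τ∈L = Equivalence.from (recognises τ) (overΣ , q , q-final , reaches)
  G[τ]∉PCD : ¬ PCD D C (G τ)
  G[τ]∉PCD G[τ]∈PCD = H∉PCD (k , τ₀ , τ₀∈L , τ₀-accepted , G[τ₀]≅H)
    where
    τ₀-accepted : AcceptedBy C k τ₀
    τ₀-accepted = AcceptedBy-resp-≋ C k {τ} {τ₀} dyn
      (PCD⇒AcceptedBy {D = D} {C} coherent τ∈L G[τ]∈PCD)
  τ<fk*d : height τ < f k * d
  τ<fk*d = ≤-trans height< (*-monoˡ-≤ d states≤fk)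
  size≤ : size τ ≤ maxSize r (f k * d)
  size≤ = size≤maxSize (Σ-arity k) overΣ τ<fk*d
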